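{- For every formula $\varphi$ of the modal language $\mathcal{L}_m$: $\varphi$ is derivable in $\mathsf{WK}$ if and only if $\varphi^\tau$ is derivable in $\mathsf{ConstCK}$.
   Context: $\mathcal{L}_m$: formulas $\varphi ::= p\mid\bot\mid\varphi\wedge\varphi\mid\varphi\vee\varphi\mid\varphi\to\varphi\mid\Box\varphi\mid\Diamond\varphi$. $\mathsf{WK}$: intuitionistic propositional logic in $\mathcal{L}_m$ with modus ponens, plus the rule from $\varphi$ infer $\Box\varphi$ and the axioms $\Box(\varphi\to\psi)\to(\Box\varphi\to\Box\psi)$, $\Box(\varphi\to\psi)\to(\Diamond\varphi\to\Diamond\psi)$, $\neg\Diamond\bot$. $\mathcal{L}$: formulas $\varphi ::= p \mid \bot \mid \varphi\wedge\varphi \mid \varphi\vee\varphi \mid \varphi\to\varphi \mid \varphi \mathbin{\Box\!\!\rightarrow} \varphi \mid \varphi \mathbin{\Diamond\!\!\rightarrow}\varphi$; $\wedge,\vee$ bind more strongly than $\to,\mathbin{\Box\!\!\rightarrow},\mathbin{\Diamond\!\!\rightarrow}$; $\neg\varphi:=\varphi\to\bot$, $\top:=\neg\bot$, $\varphi\leftrightarrow\psi:=(\varphi\to\psi)\wedge(\psi\to\varphi)$. $\mathsf{ConstCK}$: intuitionistic propositional logic in $\mathcal{L}$ with modus ponens, plus axioms CM$_\Box$: $(\varphi\mathbin{\Box\!\!\rightarrow}\psi\wedge\chi)\to(\varphi\mathbin{\Box\!\!\rightarrow}\psi)\wedge(\varphi\mathbin{\Box\!\!\rightarrow}\chi)$;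 CC$_\Box$: $(\varphi\mathbin{\Box\!\!\rightarrow}\psi)\wedge(\varphi\mathbin{\Box\!\!\rightarrow}\chi)\to(\varphi\mathbin{\Box\!\!\rightarrow}\psi\wedge\chi)$; CN$_\Box$: $\varphi\mathbin{\Box\!\!\rightarrow}\top$; CN$_\Diamond$: $\neg(\varphi\mathbin{\Diamond\!\!\rightarrow}\bot)$; CK$_\Diamond$: $(\varphi\mathbin{\Box\!\!\rightarrow}(\psi\to\chi))\to((\varphi\mathbin{\Diamond\!\!\rightarrow}\psi)\to(\varphi\mathbin{\Diamond\!\!\rightarrow}\chi))$; rules RA$_\Box$: from $\varphi\leftrightarrow\rho$ infer $(\varphi\mathbin{\Box\!\!\rightarrow}\psi)\leftrightarrow(\rho\mathbin{\Box\!\!\rightarrow}\psi)$; RC$_\Box$: from $\psi\leftrightarrow\chi$ infer $(\varphi\mathbin{\Box\!\!\rightarrow}\psi)\leftrightarrow(\varphi\mathbin{\Box\!\!\rightarrow}\chi)$; RA$_\Diamond$, RC$_\Diamond$ the same with $\mathbin{\Diamond\!\!\rightarrow}$. Translation $(\cdot)^\tau:\mathcal{L}_m\to\mathcal{L}$: $p^\tau=p$, $\bot^\tau=\bot$, $(\rho\circ\psi)^\tau=\rho^\tau\circ\psi^\tau$ for $\circ\in\{\wedge,\vee,\to\}$, $(\Box\psi)^\tau=\top\mathbin{\Box\!\!\rightarrow}\psi^\tau$, $(\Diamond\psi)^\tau=\top\mathbin{\Diamond\!\!\rightarrow}\psi^\tau$. -}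

module Defs where

open import Data.Nat using (ℕ)

data Fm : Set where
  var  : ℕ → Fm
  ⊥m   : Fm
  _∧m_ : Fm → Fm → Fm
  _∨m_ : Fm → Fm → Fm
  _⇒m_ : Fm → Fm → Fm
  □_   : Fm → Fm
  ◇_   : Fm → Fm

infixr 6 _∧m_
infixr 5 _∨m_
infixr 4 _⇒m_

¬m_ : Fm → Fm
¬m φ = φ ⇒m ⊥m

data Fc : Set where
  var  : ℕ → Fc
  ⊥c   : Fc
  _∧c_ : Fc → Fc → Fc
  _∨c_ : Fc → Fc → Fc
  _⇒c_ : Fc → Fc → Fc
  _□→_ : Fc → Fc → Fc
  _◇→_ : Fc → Fc → Fc

infixr 6 _∧c_
infixr 5 _∨c_
infixr 4 _⇒c_ _□→_ _◇→_

¬c_ : Fc → Fc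
¬c φ = φ ⇒c ⊥c

⊤c : Fc
⊤c = ¬c ⊥c

_⇔c_ : Fc → Fc → Fc
φ ⇔c ψ = (φ ⇒c ψ) ∧c (ψ ⇒c φ)

data WK⊢_ : Fm → Set where
  ax-K    : ∀ φ ψ → WK⊢ (φ ⇒m ψ ⇒m φ)
  ax-S    : ∀ φ ψ χ → WK⊢ ((φ ⇒m ψ ⇒m χ) ⇒m (φ ⇒m ψ) ⇒m φ ⇒m χ)
  ax-∧E₁  : ∀ φ ψ → WK⊢ (φ ∧m ψ ⇒m φ)
  ax-∧E₂  : ∀ φ ψ → WK⊢ (φ ∧m ψ ⇒m ψ)
  ax-∧I   : ∀ φ ψ → WK⊢ (φ ⇒m ψ ⇒m φ ∧m ψ)
  ax-∨I₁  : ∀ φ ψ → WK⊢ (φ ⇒m φ ∨m ψ)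
  ax-∨I₂  : ∀ φ ψ → WK⊢ (ψ ⇒m φ ∨m ψ)
  ax-∨E   : ∀ φ ψ χ → WK⊢ ((φ ⇒m χ) ⇒m (ψ ⇒m χ) ⇒m φ ∨m ψ ⇒m χ)
  ax-⊥E   : ∀ φ → WK⊢ (⊥m ⇒m φ)
  ax-K□   : ∀ φ ψ → WK⊢ (□ (φ ⇒m ψ) ⇒m □ φ ⇒m □ ψ)
  ax-K◇   : ∀ φ ψ → WK⊢ (□ (φ ⇒m ψ) ⇒m ◇ φ ⇒m ◇ ψ)
  ax-N◇   : WK⊢ (¬m (◇ ⊥m))
  mp      : ∀ {φ ψ} → WK⊢ (φ ⇒m ψ) → WK⊢ φ → WK⊢ ψ
  nec     : ∀ {φ} → WK⊢ φ → WK⊢ (□ φ)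

data CK⊢_ : Fc → Set where
  ax-K    : ∀ φ ψ → CK⊢ (φ ⇒c ψ ⇒c φ)
  ax-S    : ∀ φ ψ χ → CK⊢ ((φ ⇒c ψ ⇒c χ) ⇒c (φ ⇒c ψ) ⇒c φ ⇒c χ)
  ax-∧E₁  : ∀ φ ψ → CK⊢ (φ ∧c ψ ⇒c φ)
  ax-∧E₂  : ∀ φ ψ → CK⊢ (φ ∧c ψ ⇒c ψ)
  ax-∧I   : ∀ φ ψ → CK⊢ (φ ⇒c ψ ⇒c φ ∧c ψ)
  ax-∨I₁  : ∀ φ ψ → CK⊢ (φ ⇒c φ ∨c ψ)
  ax-∨I₂  : ∀ φ ψ → CK⊢ (ψ ⇒c φ ∨c ψ)
  ax-∨E   : ∀ φ ψ χ → CK⊢ ((φ ⇒c χ) ⇒c (ψ ⇒c χ) ⇒c φ ∨c ψ ⇒c χ)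
  ax-⊥E   : ∀ φ → CK⊢ (⊥c ⇒c φ)
  ax-CM□  : ∀ φ ψ χ → CK⊢ ((φ □→ ψ ∧c χ) ⇒c (φ □→ ψ) ∧c (φ □→ χ))
  ax-CC□  : ∀ φ ψ χ → CK⊢ ((φ □→ ψ) ∧c (φ □→ χ) ⇒c (φ □→ ψ ∧c χ))
  ax-CN□  : ∀ φ → CK⊢ (φ □→ ⊤c)
  ax-CN◇  : ∀ φ → CK⊢ (¬c (φ ◇→ ⊥c))
  ax-CK◇  : ∀ φ ψ χ → CK⊢ ((φ □→ (ψ ⇒c χ)) ⇒c (φ ◇→ ψ) ⇒c (φ ◇→ χ))
  mp      : ∀ {φ ψ} → CK⊢ (φ ⇒c ψ) → CK⊢ φ → CK⊢ ψ
  RA□     : ∀ {φ ρ} ψ → CK⊢ (φ ⇔c ρ) → CK⊢ ((φ □→ ψ) ⇔c (ρ □→ ψ))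
  RC□     : ∀ φ {ψ χ} → CK⊢ (ψ ⇔c χ) → CK⊢ ((φ □→ ψ) ⇔c (φ □→ χ))
  RA◇     : ∀ {φ ρ} ψ → CK⊢ (φ ⇔c ρ) → CK⊢ ((φ ◇→ ψ) ⇔c (ρ ◇→ ψ))
  RC◇     : ∀ φ {ψ χ} → CK⊢ (ψ ⇔c χ) → CK⊢ ((φ ◇→ ψ) ⇔c (φ ◇→ χ))

τ : Fm → Fc
τ (var p)  = var p
τ ⊥m       = ⊥c
τ (φ ∧m ψ) = τ φ ∧c τ ψ
τ (φ ∨m ψ) = τ φ ∨c τ ψ
τ (φ ⇒m ψ) = τ φ ⇒c τ ψ
τ (□ φ)    = ⊤c □→ τ φ
τ (◇ φ)    = ⊤c ◇→ τ φ

-- Translating derivations shows that τ preserves derivability: necessitation becomes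
-- the derivable rule "from ψ infer ⊤ □→ ψ" (ψ is then equivalent to ⊤, so RC□ and CN□
-- apply) and K□ follows from CC□ together with monotonicity of □→. Conversely, erasing
-- antecedents (φ □→ ψ ↦ □ ψ, φ ◇→ ψ ↦ ◇ ψ) is a left inverse of τ that maps ConstCK
-- into WK: every conditional axiom becomes a WK theorem, and since antecedents are
-- forgotten, the rules RA□ and RA◇ turn into instances of ψ ↔ ψ.
module Submission where

open import Defs
open import Function.Bundles using (_⇔_; mk⇔)
open import Relation.Binary.PropositionalEquality using (_≡_; refl; cong; cong₂; subst)

module Hilbert {F : Set} (_⇒_ _∧_ : F → F → F) (⊢_ : F → Set)
  (ax-K  : ∀ a b → ⊢ (a ⇒ (b ⇒ a)))
  (ax-S  : ∀ a b c → ⊢ ((a ⇒ (b ⇒ c)) ⇒ ((a ⇒ b) ⇒ (a ⇒ c))))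
  (ax-∧E₁ : ∀ a b → ⊢ ((a ∧ b) ⇒ a))
  (ax-∧E₂ : ∀ a b → ⊢ ((a ∧ b) ⇒ b))
  (ax-∧I : ∀ a b → ⊢ (a ⇒ (b ⇒ (a ∧ b))))
  (mp    : ∀ {a b} → ⊢ (a ⇒ b) → ⊢ a → ⊢ b) where

  ⇒-refl : ∀ a → ⊢ (a ⇒ a)
  ⇒-refl a = mp (mp (ax-S a (a ⇒ a) a) (ax-K a (a ⇒ a))) (ax-K a a)

  ⇒-weaken : ∀ {a} b → ⊢ a → ⊢ (b ⇒ a)
  ⇒-weaken b p = mp (ax-K _ b) p

  ⇒-apply : ∀ {c a b} → ⊢ (c ⇒ (a ⇒ b)) → ⊢ (c ⇒ a) → ⊢ (c ⇒ b)
  ⇒-apply f x = mp (mp (ax-S _ _ _) f) x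

  ⇒-trans : ∀ {a b c} → ⊢ (a ⇒ b) → ⊢ (b ⇒ c) → ⊢ (a ⇒ c)
  ⇒-trans ab bc = ⇒-apply (⇒-weaken _ bc) ab

  ⇒-pair : ∀ {a b c} → ⊢ (a ⇒ b) → ⊢ (a ⇒ c) → ⊢ (a ⇒ (b ∧ c))
  ⇒-pair ab ac = ⇒-apply (⇒-trans ab (ax-∧I _ _)) ac

  ∧-intro : ∀ {a b} → ⊢ a → ⊢ b → ⊢ (a ∧ b)
  ∧-intro x y = mp (mp (ax-∧I _ _) x) y

  ∧-proj₁ : ∀ {a b} → ⊢ (a ∧ b) → ⊢ a
  ∧-proj₁ = mp (ax-∧E₁ _ _)

  ∧-proj₂ : ∀ {a b} → ⊢ (a ∧ b) → ⊢ b
  ∧-proj₂ = mp (ax-∧E₂ _ _)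

  ∧-curry : ∀ {a b c} → ⊢ ((a ∧ b) ⇒ c) → ⊢ (a ⇒ (b ⇒ c))
  ∧-curry h = ⇒-trans (ax-∧I _ _) (mp (ax-S _ _ _) (⇒-weaken _ h))

  ∧-eval : ∀ a b → ⊢ (((a ⇒ b) ∧ a) ⇒ b)
  ∧-eval a b = ⇒-apply (ax-∧E₁ _ _) (ax-∧E₂ _ _)

module WK = Hilbert _⇒m_ _∧m_ WK⊢_ ax-K ax-S ax-∧E₁ ax-∧E₂ ax-∧I mp
module CK = Hilbert _⇒c_ _∧c_ CK⊢_ ax-K ax-S ax-∧E₁ ax-∧E₂ ax-∧I mp

□→-nec : ∀ φ {ψ} → CK⊢ ψ → CK⊢ (φ □→ ψ)
□→-nec φ p = mp (CK.∧-proj₁ (RC□ φ ⊤⇔ψ)) (ax-CN□ φ)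
  where ⊤⇔ψ = CK.∧-intro (CK.⇒-weaken _ p) (CK.⇒-weaken _ (CK.⇒-refl ⊥c))

□→-mono : ∀ φ {ψ χ} → CK⊢ (ψ ⇒c χ) → CK⊢ ((φ □→ ψ) ⇒c (φ □→ χ))
□→-mono φ ψχ = CK.⇒-trans (CK.∧-proj₁ (RC□ φ ψ⇔ψ∧χ)) (CK.⇒-trans (ax-CM□ _ _ _) (ax-∧E₂ _ _))
  where ψ⇔ψ∧χ = CK.∧-intro (CK.⇒-pair (CK.⇒-refl _) ψχ) (ax-∧E₁ _ _)

□→-K : ∀ φ ψ χ → CK⊢ ((φ □→ (ψ ⇒c χ)) ⇒c (φ □→ ψ) ⇒c (φ □→ χ))
□→-K φ ψ χ = CK.∧-curry (CK.⇒-trans (ax-CC□ _ _ _) (□→-mono φ (CK.∧-eval ψ χ)))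

WK⊢⇒CK⊢τ : ∀ {φ} → WK⊢ φ → CK⊢ τ φ
WK⊢⇒CK⊢τ (ax-K φ ψ)     = ax-K _ _
WK⊢⇒CK⊢τ (ax-S φ ψ χ)   = ax-S _ _ _
WK⊢⇒CK⊢τ (ax-∧E₁ φ ψ)   = ax-∧E₁ _ _
WK⊢⇒CK⊢τ (ax-∧E₂ φ ψ)   = ax-∧E₂ _ _
WK⊢⇒CK⊢τ (ax-∧I φ ψ)    = ax-∧I _ _
WK⊢⇒CK⊢τ (ax-∨I₁ φ ψ)   = ax-∨I₁ _ _
WK⊢⇒CK⊢τ (ax-∨I₂ φ ψ)   = ax-∨I₂ _ _
WK⊢⇒CK⊢τ (ax-∨E φ ψ χ)  = ax-∨E _ _ _
WK⊢⇒CK⊢τ (ax-⊥E φ)      = ax-⊥E _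
WK⊢⇒CK⊢τ (ax-K□ φ ψ)    = □→-K ⊤c _ _
WK⊢⇒CK⊢τ (ax-K◇ φ ψ)    = ax-CK◇ _ _ _
WK⊢⇒CK⊢τ ax-N◇          = ax-CN◇ _
WK⊢⇒CK⊢τ (mp p q)       = mp (WK⊢⇒CK⊢τ p) (WK⊢⇒CK⊢τ q)
WK⊢⇒CK⊢τ (nec p)        = □→-nec ⊤c (WK⊢⇒CK⊢τ p)

τ⁻¹ : Fc → Fm
τ⁻¹ (var p)  = var p
τ⁻¹ ⊥c       = ⊥m
τ⁻¹ (φ ∧c ψ) = τ⁻¹ φ ∧m τ⁻¹ ψ
τ⁻¹ (φ ∨c ψ) = τ⁻¹ φ ∨m τ⁻¹ ψ
τ⁻¹ (φ ⇒c ψ) = τ⁻¹ φ ⇒m τ⁻¹ ψ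
τ⁻¹ (φ □→ ψ) = □ τ⁻¹ ψ
τ⁻¹ (φ ◇→ ψ) = ◇ τ⁻¹ ψ

τ⁻¹-inverseˡ : ∀ φ → τ⁻¹ (τ φ) ≡ φ
τ⁻¹-inverseˡ (var p)  = refl
τ⁻¹-inverseˡ ⊥m       = refl
τ⁻¹-inverseˡ (φ ∧m ψ) = cong₂ _∧m_ (τ⁻¹-inverseˡ φ) (τ⁻¹-inverseˡ ψ)
τ⁻¹-inverseˡ (φ ∨m ψ) = cong₂ _∨m_ (τ⁻¹-inverseˡ φ) (τ⁻¹-inverseˡ ψ)
τ⁻¹-inverseˡ (φ ⇒m ψ) = cong₂ _⇒m_ (τ⁻¹-inverseˡ φ) (τ⁻¹-inverseˡ ψ)
τ⁻¹-inverseˡ (□ φ)    = cong □_ (τ⁻¹-inverseˡ φ)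
τ⁻¹-inverseˡ (◇ φ)    = cong ◇_ (τ⁻¹-inverseˡ φ)

□-mono : ∀ {φ ψ} → WK⊢ (φ ⇒m ψ) → WK⊢ (□ φ ⇒m □ ψ)
□-mono p = mp (ax-K□ _ _) (nec p)

◇-mono : ∀ {φ ψ} → WK⊢ (φ ⇒m ψ) → WK⊢ (◇ φ ⇒m ◇ ψ)
◇-mono p = mp (ax-K◇ _ _) (nec p)

□-∧-distrib : ∀ φ ψ → WK⊢ (□ φ ∧m □ ψ ⇒m □ (φ ∧m ψ))
□-∧-distrib φ ψ = WK.⇒-apply (WK.⇒-trans (ax-∧E₁ _ _) (WK.⇒-trans (□-mono (ax-∧I _ _)) (ax-K□ _ _)))
                             (ax-∧E₂ _ _)

⇔m-refl : ∀ φ → WK⊢ ((φ ⇒m φ) ∧m (φ ⇒m φ))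
⇔m-refl φ = WK.∧-intro (WK.⇒-refl φ) (WK.⇒-refl φ)

CK⊢⇒WK⊢τ⁻¹ : ∀ {φ} → CK⊢ φ → WK⊢ τ⁻¹ φ
CK⊢⇒WK⊢τ⁻¹ (ax-K φ ψ)     = ax-K _ _
CK⊢⇒WK⊢τ⁻¹ (ax-S φ ψ χ)   = ax-S _ _ _
CK⊢⇒WK⊢τ⁻¹ (ax-∧E₁ φ ψ)   = ax-∧E₁ _ _
CK⊢⇒WK⊢τ⁻¹ (ax-∧E₂ φ ψ)   = ax-∧E₂ _ _
CK⊢⇒WK⊢τ⁻¹ (ax-∧I φ ψ)    = ax-∧I _ _
CK⊢⇒WK⊢τ⁻¹ (ax-∨I₁ φ ψ)   = ax-∨I₁ _ _
CK⊢⇒WK⊢τ⁻¹ (ax-∨I₂ φ ψ)   = ax-∨I₂ _ _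
CK⊢⇒WK⊢τ⁻¹ (ax-∨E φ ψ χ)  = ax-∨E _ _ _
CK⊢⇒WK⊢τ⁻¹ (ax-⊥E φ)      = ax-⊥E _
CK⊢⇒WK⊢τ⁻¹ (ax-CM□ φ ψ χ) = WK.⇒-pair (□-mono (ax-∧E₁ _ _)) (□-mono (ax-∧E₂ _ _))
CK⊢⇒WK⊢τ⁻¹ (ax-CC□ φ ψ χ) = □-∧-distrib _ _
CK⊢⇒WK⊢τ⁻¹ (ax-CN□ φ)     = nec (WK.⇒-refl ⊥m)
CK⊢⇒WK⊢τ⁻¹ (ax-CN◇ φ)     = ax-N◇
CK⊢⇒WK⊢τ⁻¹ (ax-CK◇ φ ψ χ) = ax-K◇ _ _
CK⊢⇒WK⊢τ⁻¹ (mp p q)       = mp (CK⊢⇒WK⊢τ⁻¹ p) (CK⊢⇒WK⊢τ⁻¹ q)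
CK⊢⇒WK⊢τ⁻¹ (RA□ ψ p)      = ⇔m-refl _
CK⊢⇒WK⊢τ⁻¹ (RC□ φ p)      = WK.∧-intro (□-mono (WK.∧-proj₁ ψ⇔χ)) (□-mono (WK.∧-proj₂ ψ⇔χ))
  where ψ⇔χ = CK⊢⇒WK⊢τ⁻¹ p
CK⊢⇒WK⊢τ⁻¹ (RA◇ ψ p)      = ⇔m-refl _
CK⊢⇒WK⊢τ⁻¹ (RC◇ φ p)      = WK.∧-intro (◇-mono (WK.∧-proj₁ ψ⇔χ)) (◇-mono (WK.∧-proj₂ ψ⇔χ))
  where ψ⇔χ = CK⊢⇒WK⊢τ⁻¹ p

theorem8 : ∀ (φ : Fm) → (WK⊢ φ) ⇔ (CK⊢ τ φ)
theorem8 φ = mk⇔ WK⊢⇒CK⊢τ (λ p → subst WK⊢_ (τ⁻¹-inverseˡ φ) (CK⊢⇒WK⊢τ⁻¹ p))
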